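{- Let $M$ be an $\omega$-complete Boolean effect monoid. Then $M$ is an $\omega$-complete Boolean algebra.
   Context: An effect algebra is a set $E$ with an element $0$, a partial binary operation $a+b$ (the partial sum), and a total complement $a\mapsto a^\perp$, such that: the sum is commutative and associative wherever defined, $a+0=a$, $a^\perp$ is the unique element with $a+a^\perp=1$ where $1:=0^\perp$, and $a+1$ defined implies $a=0$. The order is $a\le b$ iff $b=a+c$ for some $c$. An effect monoid is an effect algebra with an associative total multiplication $\cdot$ with unit $1$ which distributes over the partial sum on both sides. It is $\omega$-complete if every increasing sequence has a supremum. An effect monoid is Boolean when every element below $1$ (i.e. every element) is idempotent ($b\cdot b=b$). -}

module Defs where

open import Level using (Level; suc)
open import Data.Nat using (ℕ) renaming (suc to sucℕ)
open import Data.Maybe using (Maybe; just)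
open import Data.Product using (Σ; _×_; _,_)
open import Relation.Binary.PropositionalEquality using (_≡_)
open import Relation.Binary.Lattice.Structures using (IsBooleanAlgebra)

-- An effect algebra.  The partial sum is a Maybe-valued operation:
-- a ⊕ b ≡ just c  means "a + b is defined and equals c".
record EffectAlgebra (ℓ : Level) : Set (suc ℓ) where
  infixl 6 _⊕_
  field
    Carrier : Set ℓ
    𝟘       : Carrier
    _⊕_     : Carrier → Carrier → Maybe Carrier
    _ᗮ      : Carrier → Carrier

  𝟙 : Carrier
  𝟙 = 𝟘 ᗮ

  field
    ⊕-comm   : ∀ a b → a ⊕ b ≡ b ⊕ a
    ⊕-assoc  : ∀ a b c ab abc → a ⊕ b ≡ just ab → ab ⊕ c ≡ just abc →
               Σ Carrier (λ bc → (b ⊕ c ≡ just bc) × (a ⊕ bc ≡ just abc))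
    ⊕-identity : ∀ a → a ⊕ 𝟘 ≡ just a
    ᗮ-sum    : ∀ a → a ⊕ (a ᗮ) ≡ just 𝟙
    ᗮ-unique : ∀ a b → a ⊕ b ≡ just 𝟙 → b ≡ a ᗮ
    zero-one : ∀ a c → a ⊕ 𝟙 ≡ just c → a ≡ 𝟘

  _≤_ : Carrier → Carrier → Set ℓ
  a ≤ b = Σ Carrier (λ c → a ⊕ c ≡ just b)

  IsSup : Carrier → (ℕ → Carrier) → Set ℓ
  IsSup s f = (∀ n → f n ≤ s) × (∀ u → (∀ n → f n ≤ u) → s ≤ u)

  Increasing : (ℕ → Carrier) → Set ℓ
  Increasing f = ∀ n → f n ≤ f (sucℕ n)

  ωComplete : Set ℓ
  ωComplete = ∀ (f : ℕ → Carrier) → Increasing f → Σ Carrier (λ s → IsSup s f)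

record EffectMonoid (ℓ : Level) : Set (suc ℓ) where
  infixl 7 _·_
  field
    effectAlgebra : EffectAlgebra ℓ
  open EffectAlgebra effectAlgebra public
  field
    _·_       : Carrier → Carrier → Carrier
    ·-assoc   : ∀ a b c → (a · b) · c ≡ a · (b · c)
    ·-identityˡ : ∀ a → 𝟙 · a ≡ a
    ·-identityʳ : ∀ a → a · 𝟙 ≡ a
    ·-distribˡ : ∀ a b c s → b ⊕ c ≡ just s → (a · b) ⊕ (a · c) ≡ just (a · s)
    ·-distribʳ : ∀ a b c s → b ⊕ c ≡ just s → (b · a) ⊕ (c · a) ≡ just (s · a)

  Boolean : Set ℓ
  Boolean = ∀ a → a · a ≡ a

  IsωCompleteBooleanAlgebra : Set ℓ
  IsωCompleteBooleanAlgebra =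
    Σ (Carrier → Carrier → Carrier) λ _∨_ →
    Σ (Carrier → Carrier → Carrier) λ _∧_ →
    Σ (Carrier → Carrier) λ ¬_ →
    Σ Carrier λ ⊤ →
    Σ Carrier λ ⊥ →
      IsBooleanAlgebra _≡_ _≤_ _∨_ _∧_ ¬_ ⊤ ⊥
      × (∀ (f : ℕ → Carrier) → Σ Carrier (λ s → IsSup s f))

-- In an effect monoid the product a · b lies below both a and
-- b, and a splits as a = a·b + a·bᗮ.  When every element is idempotent,
-- orthogonality (x · y = 0) is symmetric; this forces x · xᗮ = 0 and then
-- commutativity of the product.  Consequently c ≤ a holds exactly when
-- c · a = c, so the product is the meet, the complement is a Boolean
-- negation, and the De Morgan dual a ∨ b = (aᗮ · bᗮ)ᗮ is the join.  Finally
-- the supremum of an arbitrary sequence is the supremum of its increasing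
-- sequence of finite joins, which exists by ω-completeness.
module Submission where

open import Defs
open import Data.Nat using (ℕ; zero) renaming (suc to sucℕ)
open import Data.Maybe using (just)
open import Data.Maybe.Properties using (just-injective)
open import Data.Product using (Σ; _×_; _,_; proj₁; proj₂)
open import Relation.Binary.PropositionalEquality
open import Relation.Binary.Lattice.Structures using (IsBooleanAlgebra)

module EffectAlgebraProperties {ℓ} (E : EffectAlgebra ℓ) where
  open EffectAlgebra E hiding (_≤_)

  -- The order of E, with a fixity so that it binds more loosely than
  -- the operations used below.
  infix 4 _≤_
  _≤_ : Carrier → Carrier → Set ℓ
  _≤_ = EffectAlgebra._≤_ E

  ⊕-identityˡ : ∀ a → 𝟘 ⊕ a ≡ just a
  ⊕-identityˡ a = trans (⊕-comm 𝟘 a) (⊕-identity a)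

  ᗮ-involutive : ∀ a → a ᗮ ᗮ ≡ a
  ᗮ-involutive a = sym (ᗮ-unique (a ᗮ) a (trans (⊕-comm (a ᗮ) a) (ᗮ-sum a)))

  ᗮ-shift : ∀ {a b s} → a ⊕ b ≡ just s → b ⊕ (s ᗮ) ≡ just (a ᗮ)
  ᗮ-shift {a} {b} {s} h with ⊕-assoc a b (s ᗮ) s 𝟙 h (ᗮ-sum s)
  ... | t , b+sᗮ≡t , a+t≡𝟙 rewrite ᗮ-unique a t a+t≡𝟙 = b+sᗮ≡t

  -- Cancellation: applying ᗮ-shift twice to a + b = s gives sᗮ + aᗮᗮ = bᗮ,
  -- so bᗮ (hence b) is determined by a and s.
  ⊕-cancelˡ : ∀ {a b c s} → a ⊕ b ≡ just s → a ⊕ c ≡ just s → b ≡ c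
  ⊕-cancelˡ {a} {b} {c} h₁ h₂ = begin
    b          ≡⟨ sym (ᗮ-involutive b) ⟩
    b ᗮ ᗮ      ≡⟨ cong _ᗮ (just-injective (trans (sym (ᗮ-shift (ᗮ-shift h₁)))
                                                  (ᗮ-shift (ᗮ-shift h₂)))) ⟩
    c ᗮ ᗮ      ≡⟨ ᗮ-involutive c ⟩
    c          ∎
    where open ≡-Reasoning

  ⊕-unchanged : ∀ {a b} → a ⊕ b ≡ just a → b ≡ 𝟘
  ⊕-unchanged {a} h = ⊕-cancelˡ h (⊕-identity a)

  ⊕-𝟘ʳ : ∀ {a b c} → b ≡ 𝟘 → a ⊕ b ≡ just c → a ≡ c
  ⊕-𝟘ʳ {a} refl h = just-injective (trans (sym (⊕-identity a)) h)

  ⊕-𝟘ˡ : ∀ {a b c} → a ≡ 𝟘 → a ⊕ b ≡ just c → b ≡ c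
  ⊕-𝟘ˡ {a} {b} a≡𝟘 h = ⊕-𝟘ʳ a≡𝟘 (trans (⊕-comm b a) h)

  -- Positivity: a + b = 𝟘 forces a = 𝟘 (since then a + 𝟙 is defined).
  ⊕-positive : ∀ {a b} → a ⊕ b ≡ just 𝟘 → a ≡ 𝟘
  ⊕-positive {a} {b} h with ⊕-assoc b a 𝟙 𝟘 𝟙 (trans (⊕-comm b a) h) (⊕-identityˡ 𝟙)
  ... | a1 , a+𝟙≡a1 , _ = zero-one a a1 a+𝟙≡a1

  ≤-refl : ∀ {a} → a ≤ a
  ≤-refl {a} = 𝟘 , ⊕-identity a

  ≤-trans : ∀ {a b c} → a ≤ b → b ≤ c → a ≤ c
  ≤-trans {a} (d , a+d≡b) (e , b+e≡c) with ⊕-assoc a d e _ _ a+d≡b b+e≡c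
  ... | de , _ , a+de≡c = de , a+de≡c

  -- If a + c = b and b + d = a then c + d = 𝟘 by cancellation, so c = 𝟘.
  ≤-antisym : ∀ {a b} → a ≤ b → b ≤ a → a ≡ b
  ≤-antisym {a} (c , a+c≡b) (d , b+d≡a) with ⊕-assoc a c d _ a a+c≡b b+d≡a
  ... | cd , c+d≡cd , a+cd≡a =
    ⊕-𝟘ʳ (⊕-positive (subst (λ z → c ⊕ d ≡ just z) (⊕-unchanged a+cd≡a) c+d≡cd)) a+c≡b

  ≤-𝟙 : ∀ a → a ≤ 𝟙
  ≤-𝟙 a = a ᗮ , ᗮ-sum a

  𝟘-≤ : ∀ a → 𝟘 ≤ a
  𝟘-≤ a = a , ⊕-identityˡ a

  ≤𝟘⇒≡𝟘 : ∀ {a} → a ≤ 𝟘 → a ≡ 𝟘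
  ≤𝟘⇒≡𝟘 (_ , h) = ⊕-positive h

  summand≤ᗮ : ∀ {a d s} → a ⊕ d ≡ just s → d ≤ a ᗮ
  summand≤ᗮ {s = s} h = s ᗮ , ᗮ-shift h

  ᗮ-antitone : ∀ {a b} → a ≤ b → b ᗮ ≤ a ᗮ
  ᗮ-antitone (d , a+d≡b) = d , trans (⊕-comm _ d) (ᗮ-shift a+d≡b)

  ᗮ-swapʳ : ∀ {a b} → a ≤ b ᗮ → b ≤ a ᗮ
  ᗮ-swapʳ {b = b} h = subst (_≤ _) (ᗮ-involutive b) (ᗮ-antitone h)

  ᗮ-swapˡ : ∀ {a b} → a ᗮ ≤ b → b ᗮ ≤ a
  ᗮ-swapˡ {a} h = subst (_ ≤_) (ᗮ-involutive a) (ᗮ-antitone h)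

module EffectMonoidProperties {ℓ} (M : EffectMonoid ℓ) where
  open EffectMonoid M hiding (_≤_)
  open EffectAlgebraProperties effectAlgebra public

  ·-zeroʳ : ∀ x → x · 𝟘 ≡ 𝟘
  ·-zeroʳ x = ⊕-unchanged (·-distribˡ x 𝟘 𝟘 𝟘 (⊕-identity 𝟘))

  ·-zeroˡ : ∀ x → 𝟘 · x ≡ 𝟘
  ·-zeroˡ x = ⊕-unchanged (·-distribʳ x 𝟘 𝟘 𝟘 (⊕-identity 𝟘))

  ·-splitˡ : ∀ a b → (a · b) ⊕ (a · b ᗮ) ≡ just a
  ·-splitˡ a b = subst (λ v → (a · b) ⊕ (a · b ᗮ) ≡ just v) (·-identityʳ a)
                       (·-distribˡ a b (b ᗮ) 𝟙 (ᗮ-sum b))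

  ·-splitʳ : ∀ a b → (b · a) ⊕ (b ᗮ · a) ≡ just a
  ·-splitʳ a b = subst (λ v → (b · a) ⊕ (b ᗮ · a) ≡ just v) (·-identityˡ a)
                       (·-distribʳ a b (b ᗮ) 𝟙 (ᗮ-sum b))

  ·-lowerˡ : ∀ a b → a · b ≤ a
  ·-lowerˡ a b = a · b ᗮ , ·-splitˡ a b

  ·-lowerʳ : ∀ a b → a · b ≤ b
  ·-lowerʳ a b = a ᗮ · b , ·-splitʳ b a

  ·-monoʳ : ∀ {x y} z → x ≤ y → x · z ≤ y · z
  ·-monoʳ {x} {y} z (d , x+d≡y) = d · z , ·-distribʳ z x d y x+d≡y

module BooleanEffectMonoid {ℓ} (M : EffectMonoid ℓ) (idem : EffectMonoid.Boolean M) where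
  open EffectMonoid M hiding (_≤_)
  open EffectMonoidProperties M public

  -- Orthogonality is symmetric: y·x = (y·x)(y·x) = y·(x·y)·x = 0.
  orthogonal-sym : ∀ {x y} → x · y ≡ 𝟘 → y · x ≡ 𝟘
  orthogonal-sym {x} {y} x·y≡𝟘 = begin
    y · x                ≡⟨ sym (idem (y · x)) ⟩
    (y · x) · (y · x)    ≡⟨ ·-assoc y x (y · x) ⟩
    y · (x · (y · x))    ≡⟨ cong (y ·_) (sym (·-assoc x y x)) ⟩
    y · ((x · y) · x)    ≡⟨ cong (λ z → y · (z · x)) x·y≡𝟘 ⟩
    y · (𝟘 · x)          ≡⟨ cong (y ·_) (·-zeroˡ x) ⟩
    y · 𝟘                ≡⟨ ·-zeroʳ y ⟩
    𝟘                    ∎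
    where open ≡-Reasoning

  -- x = x·x + x·xᗮ = x + x·xᗮ, so x·xᗮ = 0.
  ·-ᗮʳ : ∀ x → x · x ᗮ ≡ 𝟘
  ·-ᗮʳ x = ⊕-unchanged (subst (λ u → u ⊕ (x · x ᗮ) ≡ just x) (idem x) (·-splitˡ x x))

  ·-ᗮˡ : ∀ x → x ᗮ · x ≡ 𝟘
  ·-ᗮˡ x = orthogonal-sym (·-ᗮʳ x)

  -- Splitting along a gives a·b = (a·b)·a and b·a = a·(b·a), because the
  -- complementary parts (a·b)·aᗮ and aᗮ·(b·a) are orthogonal to a.
  ·-comm : ∀ a b → a · b ≡ b · a
  ·-comm a b = begin
    a · b          ≡⟨ sym (⊕-𝟘ʳ ab·aᗮ≡𝟘 (·-splitˡ (a · b) a)) ⟩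
    (a · b) · a    ≡⟨ ·-assoc a b a ⟩
    a · (b · a)    ≡⟨ ⊕-𝟘ʳ aᗮ·ba≡𝟘 (·-splitʳ (b · a) a) ⟩
    b · a          ∎
    where
    open ≡-Reasoning
    ab·aᗮ≡𝟘 : (a · b) · a ᗮ ≡ 𝟘
    ab·aᗮ≡𝟘 = orthogonal-sym (trans (sym (·-assoc (a ᗮ) a b))
                                    (trans (cong (_· b) (·-ᗮˡ a)) (·-zeroˡ b)))
    aᗮ·ba≡𝟘 : a ᗮ · (b · a) ≡ 𝟘
    aᗮ·ba≡𝟘 = orthogonal-sym (trans (·-assoc b a (a ᗮ))
                                    (trans (cong (b ·_) (·-ᗮʳ a)) (·-zeroʳ b)))

  orthogonal⇒≤ᗮ : ∀ {p q} → p · q ≡ 𝟘 → p ≤ q ᗮ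
  orthogonal⇒≤ᗮ {p} {q} p·q≡𝟘 =
    subst (_≤ q ᗮ) (⊕-𝟘ˡ p·q≡𝟘 (·-splitˡ p q)) (·-lowerʳ p (q ᗮ))

  ≤ᗮ⇒orthogonal : ∀ {p q} → p ≤ q ᗮ → p · q ≡ 𝟘
  ≤ᗮ⇒orthogonal {p} {q} p≤qᗮ = ≤𝟘⇒≡𝟘 (subst (p · q ≤_) (·-ᗮˡ q) (·-monoʳ q p≤qᗮ))

  -- The order is determined by the product: c ≤ a iff c · a = c.
  -- If c + d = a then d ≤ cᗮ, so c·d = 0 and c·a = c·c + c·d = c.
  ≤⇒·≡ : ∀ {c a} → c ≤ a → c · a ≡ c
  ≤⇒·≡ {c} {a} (d , c+d≡a) = sym (⊕-𝟘ʳ c·d≡𝟘 c+c·d≡c·a)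
    where
    c·d≡𝟘 : c · d ≡ 𝟘
    c·d≡𝟘 = orthogonal-sym (≤ᗮ⇒orthogonal (summand≤ᗮ c+d≡a))
    c+c·d≡c·a : c ⊕ (c · d) ≡ just (c · a)
    c+c·d≡c·a = subst (λ u → u ⊕ (c · d) ≡ just (c · a)) (idem c) (·-distribˡ c c d a c+d≡a)

  ·≡⇒≤ : ∀ {c a} → c · a ≡ c → c ≤ a
  ·≡⇒≤ {c} {a} c·a≡c = subst (_≤ a) c·a≡c (·-lowerʳ c a)

  ·-greatest : ∀ {c a b} → c ≤ a → c ≤ b → c ≤ a · b
  ·-greatest {c} {a} {b} c≤a c≤b = ·≡⇒≤ (begin
    c · (a · b)    ≡⟨ sym (·-assoc c a b) ⟩
    (c · a) · b    ≡⟨ cong (_· b) (≤⇒·≡ c≤a) ⟩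
    c · b          ≡⟨ ≤⇒·≡ c≤b ⟩
    c              ∎)
    where open ≡-Reasoning

  infixr 6 _∨_
  _∨_ : Carrier → Carrier → Carrier
  a ∨ b = (a ᗮ · b ᗮ) ᗮ

  ∨-upperˡ : ∀ a b → a ≤ a ∨ b
  ∨-upperˡ a b = ᗮ-swapʳ (·-lowerˡ (a ᗮ) (b ᗮ))

  ∨-upperʳ : ∀ a b → b ≤ a ∨ b
  ∨-upperʳ a b = ᗮ-swapʳ (·-lowerʳ (a ᗮ) (b ᗮ))

  ∨-least : ∀ {a b c} → a ≤ c → b ≤ c → a ∨ b ≤ c
  ∨-least a≤c b≤c = ᗮ-swapˡ (·-greatest (ᗮ-antitone a≤c) (ᗮ-antitone b≤c))

  -- Residuation: w·x ≤ y iff (w·x)·yᗮ = 0 iff w ≤ (x·yᗮ)ᗮ = xᗮ ∨ y.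
  ≤⇔orthogonal-ᗮ : ∀ {a b} → (a ≤ b → a · b ᗮ ≡ 𝟘) × (a · b ᗮ ≡ 𝟘 → a ≤ b)
  ≤⇔orthogonal-ᗮ {a} {b} =
    (λ a≤b → ≤ᗮ⇒orthogonal (subst (a ≤_) (sym (ᗮ-involutive b)) a≤b)) ,
    (λ a·bᗮ≡𝟘 → subst (a ≤_) (ᗮ-involutive b) (orthogonal⇒≤ᗮ a·bᗮ≡𝟘))

  ᗮ∨≡ : ∀ x y → x ᗮ ∨ y ≡ (x · y ᗮ) ᗮ
  ᗮ∨≡ x y = cong (λ z → (z · y ᗮ) ᗮ) (ᗮ-involutive x)

  residuation : ∀ w x y → (w · x ≤ y → w ≤ x ᗮ ∨ y) × (w ≤ x ᗮ ∨ y → w · x ≤ y)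
  residuation w x y = to , from
    where
    to : w · x ≤ y → w ≤ x ᗮ ∨ y
    to h = subst (w ≤_) (sym (ᗮ∨≡ x y))
             (orthogonal⇒≤ᗮ (trans (sym (·-assoc w x (y ᗮ))) (proj₁ ≤⇔orthogonal-ᗮ h)))
    from : w ≤ x ᗮ ∨ y → w · x ≤ y
    from h = proj₂ ≤⇔orthogonal-ᗮ
               (trans (·-assoc w x (y ᗮ)) (≤ᗮ⇒orthogonal (subst (w ≤_) (ᗮ∨≡ x y) h)))

  isBooleanAlgebra : IsBooleanAlgebra _≡_ _≤_ _∨_ _·_ _ᗮ 𝟙 𝟘
  isBooleanAlgebra = record
    { isHeytingAlgebra = record
      { isBoundedLattice = record
        { isLattice = record
          { isPartialOrder = record
            { isPreorder = record
              { isEquivalence = isEquivalence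
              ; reflexive = λ { refl → ≤-refl }
              ; trans = ≤-trans }
            ; antisym = ≤-antisym }
          ; supremum = λ a b → ∨-upperˡ a b , ∨-upperʳ a b , λ _ → ∨-least
          ; infimum = λ a b → ·-lowerˡ a b , ·-lowerʳ a b , λ _ → ·-greatest }
        ; maximum = ≤-𝟙
        ; minimum = 𝟘-≤ }
      ; exponential = residuation } }

-- In an ω-complete effect algebra with binary joins every sequence has a
-- supremum: that of its increasing sequence of finite joins.
module CountableJoins {ℓ} (E : EffectAlgebra ℓ)
    (_∨_ : EffectAlgebra.Carrier E → EffectAlgebra.Carrier E → EffectAlgebra.Carrier E)
    (∨-upperˡ : ∀ a b → EffectAlgebra._≤_ E a (a ∨ b))
    (∨-upperʳ : ∀ a b → EffectAlgebra._≤_ E b (a ∨ b))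
    (∨-least : ∀ {a b c} → EffectAlgebra._≤_ E a c → EffectAlgebra._≤_ E b c →
               EffectAlgebra._≤_ E (a ∨ b) c) where
  open EffectAlgebra E hiding (_≤_)
  open EffectAlgebraProperties E

  partialJoin : (ℕ → Carrier) → ℕ → Carrier
  partialJoin f zero = f zero
  partialJoin f (sucℕ n) = partialJoin f n ∨ f (sucℕ n)

  partialJoin-increasing : ∀ f → Increasing (partialJoin f)
  partialJoin-increasing f n = ∨-upperˡ (partialJoin f n) (f (sucℕ n))

  ≤-partialJoin : ∀ f n → f n ≤ partialJoin f n
  ≤-partialJoin f zero = ≤-refl
  ≤-partialJoin f (sucℕ n) = ∨-upperʳ (partialJoin f n) (f (sucℕ n))

  partialJoin-least : ∀ f u → (∀ n → f n ≤ u) → ∀ n → partialJoin f n ≤ u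
  partialJoin-least f u f≤u zero = f≤u zero
  partialJoin-least f u f≤u (sucℕ n) = ∨-least (partialJoin-least f u f≤u n) (f≤u (sucℕ n))

  supremum : ωComplete → ∀ (f : ℕ → Carrier) → Σ Carrier (λ s → IsSup s f)
  supremum ωc f with ωc (partialJoin f) (partialJoin-increasing f)
  ... | s , upper , least =
    s , (λ n → ≤-trans (≤-partialJoin f n) (upper n)) ,
        (λ u f≤u → least u (partialJoin-least f u f≤u))

proposition47 : ∀ {ℓ} (M : EffectMonoid ℓ) →
    EffectMonoid.ωComplete M → EffectMonoid.Boolean M →
    EffectMonoid.IsωCompleteBooleanAlgebra M
proposition47 M ωc idem =
  _∨_ , _·_ , _ᗮ , 𝟙 , 𝟘 , isBooleanAlgebra ,
  CountableJoins.supremum effectAlgebra _∨_ ∨-upperˡ ∨-upperʳ ∨-least ωc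
  where
  open EffectMonoid M using (_·_; _ᗮ; 𝟙; 𝟘; effectAlgebra)
  open BooleanEffectMonoid M idem using (_∨_; ∨-upperˡ; ∨-upperʳ; ∨-least; isBooleanAlgebra)
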